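{- Let $v\ge1$, $n=2^v$, and let $\xi\in\mathbf{K}[\![v,1]\!]$ be a characteristic minmatrix with $\xi\ne\emptyset$. Then: (DR1) $\xi$ includes at least one of $\mathrm{Vv}_0$ or $\mathrm{Dd}_0$; (DR2) for $1\le k<n$, $\xi$ includes $\mathrm{Dw}_k$ only if it includes $\mathrm{Dd}_0$ and all $\mathrm{Dw}_l$ with $1\le l<k$; (DR3) for $1\le k<n$, $\xi$ includes $\mathrm{Dc}_k$ only if it includes $\mathrm{Dd}_0$, all $\mathrm{Dw}_l$ with $1\le l<k$, and all $\mathrm{Dc}_l$ with $1\le l<k$. (Here "includes" means inclusion as a subset of minterms.)
   Context: $m_0,\dots,m_{n-1}$ enumerate the $n=2^v$ Boolean minterms $\bigwedge_{k=0}^{v-1}\pm p_k$; $\Diamond^1m_i=\Diamond m_i$, $\Diamond^0m_i=\neg\Diamond m_i$. $\mathbf{K}[v,1]$ is the Lindenbaum–Tarski algebra (modulo provable equivalence in the least normal modal logic $\mathbf{K}$) of formulas in $p_0,\dots,p_{v-1}$ of modal degree $\le1$; its atoms (minterms) are the formulas $m_s\wedge\bigwedge_{i=0}^{n-1}\Diamond^{\varepsilon_i}m_i$ ($0\le s<n$, $\varepsilon\in\{0,1\}^n$), and each element $\varphi$ is identified with its set $[\varphi]$ of minterms. For a normal modal logic $\mathbf{S}$ (normal extension of $\mathbf{K}$), $[\![\mathbf{S}]\!]=\bigcap\{[\varphi]:\varphi\in\mathbf{K}[v,1],\ \mathbf{S}\vdash\varphi\}$, and $\mathbf{K}[\![v,1]\!]$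 is the set of all such characteristic minmatrices (the inconsistent logic gives $\emptyset$). The following sets of minterms (with $s$ ranging over $0,\dots,n-1$) are defined: $\mathrm{Vv}_0$: all $\varepsilon_i=0$; $\mathrm{Dd}_0$: $\varepsilon_s=1$, $\varepsilon_i=0$ for $i\ne s$; $\mathrm{Dc}_k$ ($1\le k<n$): $\varepsilon_s=0$ and exactly $k$ indices $i\ne s$ with $\varepsilon_i=1$; $\mathrm{Dw}_k$ ($1\le k<n$): $\varepsilon_s=1$ and exactly $k$ indices $i\ne s$ with $\varepsilon_i=1$. -}

module Defs where

open import Data.Nat using (ℕ; zero; suc; _+_; _^_; _≤_; _<_; _⊔_; ⌊_/2⌋)
open import Data.Bool using (Bool; true; false; not; _∧_; if_then_else_)
open import Data.Fin using (Fin; zero; suc; toℕ; _≟_)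
open import Data.List using (List; foldr; map)
open import Data.List.Base using () renaming (map to lmap)
open import Data.Fin.Base using () 
open import Data.Vec.Functional using ()
open import Data.Product using (Σ; _×_; _,_)
open import Relation.Nullary using (¬_; does)
open import Relation.Binary.PropositionalEquality using (_≡_; _≢_)

infixr 5 _⇒_

data Form : Set where
  var : ℕ → Form
  ⊥'  : Form
  _⇒_ : Form → Form → Form
  □   : Form → Form

¬' : Form → Form
¬' φ = φ ⇒ ⊥'

⊤' : Form
⊤' = ¬' ⊥'

_∧'_ : Form → Form → Form
φ ∧' ψ = ¬' (φ ⇒ ¬' ψ)

◇ : Form → Form
◇ φ = ¬' (□ (¬' φ))

⋀ : List Form → Form
⋀ = foldr _∧'_ ⊤'

deg : Form → ℕ
deg (var _) = 0
deg ⊥' = 0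
deg (φ ⇒ ψ) = deg φ ⊔ deg ψ
deg (□ φ) = suc (deg φ)

data InLang (v : ℕ) : Form → Set where
  var : ∀ {k} → k < v → InLang v (var k)
  ⊥'  : InLang v ⊥'
  _⇒_ : ∀ {φ ψ} → InLang v φ → InLang v ψ → InLang v (φ ⇒ ψ)
  □   : ∀ {φ} → InLang v φ → InLang v (□ φ)

sub : (ℕ → Form) → Form → Form
sub σ (var k) = σ k
sub σ ⊥' = ⊥'
sub σ (φ ⇒ ψ) = sub σ φ ⇒ sub σ ψ
sub σ (□ φ) = □ (sub σ φ)

data K⊢_ : Form → Set where
  ax1 : ∀ φ ψ → K⊢ (φ ⇒ (ψ ⇒ φ))
  ax2 : ∀ φ ψ χ → K⊢ ((φ ⇒ (ψ ⇒ χ)) ⇒ ((φ ⇒ ψ) ⇒ (φ ⇒ χ)))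
  ax3 : ∀ φ → K⊢ (¬' (¬' φ) ⇒ φ)
  axK : ∀ φ ψ → K⊢ (□ (φ ⇒ ψ) ⇒ (□ φ ⇒ □ ψ))
  mp  : ∀ {φ ψ} → K⊢ (φ ⇒ ψ) → K⊢ φ → K⊢ ψ
  nec : ∀ {φ} → K⊢ φ → K⊢ □ φ

-- A normal modal logic (normal extension of K), given as its set of
-- theorems: contains K, closed under MP, necessitation and uniform
-- substitution.  (The inconsistent logic is allowed.)
record IsNormalLogic (S : Form → Set) : Set where
  field
    K⊆S   : ∀ {φ} → K⊢ φ → S φ
    mpS   : ∀ {φ ψ} → S (φ ⇒ ψ) → S φ → S ψ
    necS  : ∀ {φ} → S φ → S (□ φ)
    subS  : ∀ {φ} (σ : ℕ → Form) → S φ → S (sub σ φ)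

-- Boolean minterms m₀ … m_{n-1}, n = 2^v.  Convention: p_k occurs
-- positively in m_i iff bit k of i is 1.

oddb : ℕ → Bool
oddb zero = false
oddb (suc m) = not (oddb m)

bit : ℕ → ℕ → Bool
bit zero m = oddb m
bit (suc k) m = bit k ⌊ m /2⌋

allFin : (m : ℕ) → List (Fin m)
allFin zero = Data.List.List.[]
allFin (suc m) = zero Data.List.List.∷ map suc (allFin m)

lit : Bool → Form → Form
lit true φ = φ
lit false φ = ¬' φ

mtm : (v : ℕ) → Fin (2 ^ v) → Form
mtm v i = ⋀ (map (λ k → lit (bit (toℕ k) (toℕ i)) (var (toℕ k))) (allFin v))

-- minterms (atoms) of K[v,1]: pairs (s , ε)
Atom : ℕ → Set
Atom v = Fin (2 ^ v) × (Fin (2 ^ v) → Bool)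

atomF : (v : ℕ) → Atom v → Form
atomF v (s , ε) =
  mtm v s ∧' ⋀ (map (λ i → lit (ε i) (◇ (mtm v i))) (allFin (2 ^ v)))

below : (v : ℕ) → Form → Atom v → Set
below v φ a = K⊢ (atomF v a ⇒ φ)

⟦⟦_⟧⟧ : (S : Form → Set) → (v : ℕ) → Atom v → Set
⟦⟦ S ⟧⟧ v a = ∀ φ → InLang v φ → deg φ ≤ 1 → S φ → below v φ a

count : ∀ {m} → (Fin m → Bool) → ℕ
count {zero} f = 0
count {suc m} f = (if f zero then 1 else 0) + count (λ i → f (suc i))

othersOn : ∀ {m} → Fin m → (Fin m → Bool) → ℕ
othersOn s ε = count (λ i → ε i ∧ not (does (i ≟ s)))

Vv₀ : (v : ℕ) → Atom v → Set
Vv₀ v (s , ε) = ∀ i → ε i ≡ false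

Dd₀ : (v : ℕ) → Atom v → Set
Dd₀ v (s , ε) = ε s ≡ true × (∀ i → i ≢ s → ε i ≡ false)

Dc : (v : ℕ) → ℕ → Atom v → Set
Dc v k (s , ε) = ε s ≡ false × othersOn s ε ≡ k

Dw : (v : ℕ) → ℕ → Atom v → Set
Dw v k (s , ε) = ε s ≡ true × othersOn s ε ≡ k

Incl : (v : ℕ) → (Atom v → Set) → (Atom v → Set) → Set
Incl v P Q = ∀ (a : Atom v) → P a → Q a

{-# OPTIONS --safe #-}
-- An atom (s , ε) of K[v,1] is true at the root of a two-level Kripke model: the root
-- carries minterm s and sees exactly the leaves i with ε i, leaf i carrying minterm i.
-- K is sound for these models, and by Kalmár's argument the atom proves every formula
-- of degree ≤ 1 that holds at the root of its model. Now let g map the successors A of t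
-- onto the successors B of s, with g t = s. The substitution making p_k true at minterm j
-- iff it is true at minterm g j turns the model of (t , A) into one equivalent to that of
-- (s , B); since normal logics are closed under substitution, every characteristic
-- minmatrix containing (t , A) contains (s , B). (DR1)–(DR3) follow by choosing g:
-- constant maps, retractions of an enlarged successor set onto B, and, for (DR3), a
-- retraction that sends an irreflexive root t onto the reflexive root s.
module Submission where

open import Defs
open import Data.Bool using (Bool; true; false; not; _∧_; _∨_; if_then_else_)
open import Data.Bool.Properties using (∨-zeroʳ; ∨-identityʳ; ∧-zeroʳ; ∧-identityʳ; ∧-conicalˡ; ∧-conicalʳ; not-involutive)
open import Data.Fin using (Fin; zero; suc; toℕ; fromℕ<; _≟_)
open import Data.Fin.Properties using (toℕ<n; toℕ-fromℕ<; toℕ-injective; suc-injective)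
open import Data.List using (List; []; _∷_; map; _++_)
open import Data.List.Membership.Propositional using (_∈_)
open import Data.List.Membership.Propositional.Properties using (∈-map⁺; ∈-++⁺ˡ; ∈-++⁺ʳ)
open import Data.List.Relation.Unary.All using (All; []; _∷_; universal)
open import Data.List.Relation.Unary.All.Properties using (map⁺)
open import Data.List.Relation.Unary.Any using (here; there)
open import Data.Nat using (ℕ; zero; suc; _+_; _∸_; _*_; _^_; _≤_; _<_; ⌊_/2⌋; z≤n; s≤s; s≤s⁻¹)
open import Data.Nat.Properties using (module ≤-Reasoning; ≤-trans; ≤-reflexive; +-monoʳ-≤; +-monoˡ-≤; *-monoˡ-≤; *-cancelʳ-<; *-comm; m≤n+m; ⊔-lub; ⊔-mono-≤; m⊔n≤o⇒m≤o; m⊔n≤o⇒n≤o; +-suc; m∸n+n≡m; <⇒≤; n≤1+n)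
open import Data.Empty using (⊥-elim)
open import Data.Product using (_×_; _,_; proj₁; proj₂; ∃)
open import Data.Sum using (_⊎_; inj₁; inj₂)
open import Data.Vec using (Vec; []; _∷_; lookup; tabulate)
open import Function using (_∘_)
open import Relation.Nullary using (does; yes; no)
open import Relation.Nullary.Decidable using (dec-true; dec-false)
open import Relation.Binary.PropositionalEquality using (_≡_; _≢_; refl; sym; trans; cong; cong₂; subst; module ≡-Reasoning)

-- Natural deduction for K

infixr 4 _⇛_
_⇛_ : List Form → Form → Form
[] ⇛ φ = φ
(ψ ∷ Γ) ⇛ φ = Γ ⇛ (ψ ⇒ φ)

-- Γ ⊢ φ: K proves φ under the hypotheses Γ, curried with the head of Γ innermost.
infix 3 _⊢_
record _⊢_ (Γ : List Form) (φ : Form) : Set where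
  constructor ⟨_⟩
  field discharged : K⊢ (Γ ⇛ φ)
open _⊢_

⇒-intro : ∀ {Γ ψ φ} → ψ ∷ Γ ⊢ φ → Γ ⊢ ψ ⇒ φ
⇒-intro ⟨ p ⟩ = ⟨ p ⟩

⇒-intro⁻ : ∀ {Γ ψ φ} → Γ ⊢ ψ ⇒ φ → ψ ∷ Γ ⊢ φ
⇒-intro⁻ ⟨ p ⟩ = ⟨ p ⟩

K⊢-id : ∀ φ → K⊢ (φ ⇒ φ)
K⊢-id φ = mp (mp (ax2 φ (φ ⇒ φ) φ) (ax1 φ (φ ⇒ φ))) (ax1 φ φ)

K⊢-weaken : ∀ Γ {φ} → K⊢ φ → K⊢ (Γ ⇛ φ)
K⊢-weaken [] p = p
K⊢-weaken (ψ ∷ Γ) {φ} p = K⊢-weaken Γ (mp (ax1 φ ψ) p)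

theorem : ∀ {Γ φ} → K⊢ φ → Γ ⊢ φ
theorem {Γ} p = ⟨ K⊢-weaken Γ p ⟩

K⊢-mp-under : ∀ Γ {φ ψ} → K⊢ (Γ ⇛ (φ ⇒ ψ)) → K⊢ (Γ ⇛ φ) → K⊢ (Γ ⇛ ψ)
K⊢-mp-under [] p q = mp p q
K⊢-mp-under (χ ∷ Γ) {φ} {ψ} p q =
  K⊢-mp-under Γ (K⊢-mp-under Γ (K⊢-weaken Γ (ax2 χ φ ψ)) p) q

⇒-elim : ∀ {Γ φ ψ} → Γ ⊢ φ ⇒ ψ → Γ ⊢ φ → Γ ⊢ ψ
⇒-elim {Γ} ⟨ p ⟩ ⟨ q ⟩ = ⟨ K⊢-mp-under Γ p q ⟩

weaken : ∀ {Γ χ φ} → Γ ⊢ φ → χ ∷ Γ ⊢ φ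
weaken {χ = χ} {φ} p = ⇒-intro⁻ (⇒-elim (theorem (ax1 φ χ)) p)

assumption : ∀ {Γ φ} → φ ∈ Γ → Γ ⊢ φ
assumption {ψ ∷ Γ} (here refl) = ⇒-intro⁻ (theorem (K⊢-id ψ))
assumption (there φ∈Γ) = weaken (assumption φ∈Γ)

#0 : ∀ {Γ a} → a ∷ Γ ⊢ a
#0 = assumption (here refl)

#1 : ∀ {Γ a b} → b ∷ a ∷ Γ ⊢ a
#1 = assumption (there (here refl))

#2 : ∀ {Γ a b c} → c ∷ b ∷ a ∷ Γ ⊢ a
#2 = assumption (there (there (here refl)))

by-contradiction : ∀ {Γ φ} → ¬' φ ∷ Γ ⊢ ⊥' → Γ ⊢ φ
by-contradiction {φ = φ} p = ⇒-elim (theorem (ax3 φ)) (⇒-intro p)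

explode : ∀ {Γ φ} → Γ ⊢ ⊥' → Γ ⊢ φ
explode p = by-contradiction (weaken p)

excluded-middle : ∀ {Γ p φ} → Γ ⊢ p ⇒ φ → Γ ⊢ ¬' p ⇒ φ → Γ ⊢ φ
excluded-middle a b =
  by-contradiction (⇒-elim #0 (⇒-elim (weaken b) (⇒-intro (⇒-elim #1 (⇒-elim (weaken (weaken a)) #0)))))

∧-intro : ∀ {Γ φ ψ} → Γ ⊢ φ → Γ ⊢ ψ → Γ ⊢ φ ∧' ψ
∧-intro p q = ⇒-intro (⇒-elim (⇒-elim #0 (weaken p)) (weaken q))

∧-elim₁ : ∀ {Γ φ ψ} → Γ ⊢ φ ∧' ψ → Γ ⊢ φ
∧-elim₁ p = by-contradiction (⇒-elim (weaken p) (⇒-intro (⇒-intro (⇒-elim #2 #1))))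

∧-elim₂ : ∀ {Γ φ ψ} → Γ ⊢ φ ∧' ψ → Γ ⊢ ψ
∧-elim₂ p = by-contradiction (⇒-elim (weaken p) (⇒-intro #1))

⋀-intro : ∀ {Γ L} → All (Γ ⊢_) L → Γ ⊢ ⋀ L
⋀-intro [] = ⇒-intro #0
⋀-intro (p ∷ ps) = ∧-intro p (⋀-intro ps)

⋀-elim : ∀ {Γ φ L} → φ ∈ L → Γ ⊢ ⋀ L → Γ ⊢ φ
⋀-elim (here refl) p = ∧-elim₁ p
⋀-elim (there φ∈L) p = ⋀-elim φ∈L (∧-elim₂ p)

□-mp : ∀ {Γ a b} → Γ ⊢ □ (a ⇒ b) → Γ ⊢ □ a → Γ ⊢ □ b
□-mp {a = a} {b} p q = ⇒-elim (⇒-elim (theorem (axK a b)) p) q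

□-nec : ∀ {Γ a} → K⊢ a → Γ ⊢ □ a
□-nec p = theorem (nec p)

closed : ∀ {φ} → [] ⊢ φ → K⊢ φ
closed = discharged

□-⋀-intro : ∀ {Γ L} → All (λ ψ → Γ ⊢ □ ψ) L → Γ ⊢ □ (⋀ L)
□-⋀-intro [] = □-nec (K⊢-id ⊥')
□-⋀-intro (p ∷ ps) = □-mp (□-mp (□-nec (closed (⇒-intro (⇒-intro (∧-intro #1 #0))))) p) (□-⋀-intro ps)

toBit : Bool → ℕ
toBit true = 1
toBit false = 0

oddb-double : ∀ x → oddb (x * 2) ≡ false
oddb-double zero = refl
oddb-double (suc x) = trans (not-involutive _) (oddb-double x)

oddb-bit+double : ∀ b x → oddb (toBit b + x * 2) ≡ b
oddb-bit+double true x = cong not (oddb-double x)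
oddb-bit+double false x = oddb-double x

half-bit+double : ∀ b x → ⌊ toBit b + x * 2 /2⌋ ≡ x
half-bit+double false zero = refl
half-bit+double false (suc x) = cong suc (half-bit+double false x)
half-bit+double true zero = refl
half-bit+double true (suc x) = cong suc (half-bit+double true x)

parity-half : ∀ a → a ≡ toBit (oddb a) + ⌊ a /2⌋ * 2
parity-half zero = refl
parity-half (suc zero) = refl
parity-half (suc (suc a)) with oddb a | parity-half a
... | true | e = cong (λ x → suc (suc x)) e
... | false | e = cong (λ x → suc (suc x)) e

2^-suc : ∀ v → 2 ^ suc v ≡ 2 ^ v * 2
2^-suc v = *-comm 2 (2 ^ v)

toBit≤1 : ∀ b → toBit b ≤ 1
toBit≤1 true = s≤s z≤n
toBit≤1 false = z≤n

bit+double-< : ∀ b x y → x < y → toBit b + x * 2 < y * 2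
bit+double-< b x (suc y) (s≤s x≤y) =
  ≤-trans (s≤s (+-monoʳ-≤ (toBit b) (*-monoˡ-≤ 2 x≤y))) (s≤s (+-monoˡ-≤ (y * 2) (toBit≤1 b)))

half-< : ∀ v a → a < 2 ^ suc v → ⌊ a /2⌋ < 2 ^ v
half-< v a a< = *-cancelʳ-< 2 ⌊ a /2⌋ (2 ^ v) (begin-strict
  ⌊ a /2⌋ * 2                    ≤⟨ m≤n+m _ (toBit (oddb a)) ⟩
  toBit (oddb a) + ⌊ a /2⌋ * 2   ≡⟨ sym (parity-half a) ⟩
  a                              <⟨ a< ⟩
  2 ^ suc v                      ≡⟨ 2^-suc v ⟩
  2 ^ v * 2                      ∎)
  where open ≤-Reasoning

bits-injective : ∀ v a b → a < 2 ^ v → b < 2 ^ v → (∀ k → k < v → bit k a ≡ bit k b) → a ≡ b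
bits-injective zero zero zero _ _ _ = refl
bits-injective zero (suc a) b (s≤s ()) _ _
bits-injective zero zero (suc b) _ (s≤s ()) _
bits-injective (suc v) a b a< b< same-bits = begin
  a                                ≡⟨ parity-half a ⟩
  toBit (oddb a) + ⌊ a /2⌋ * 2     ≡⟨ cong₂ (λ x y → toBit x + y * 2) (same-bits 0 (s≤s z≤n)) halves ⟩
  toBit (oddb b) + ⌊ b /2⌋ * 2     ≡⟨ sym (parity-half b) ⟩
  b                                ∎
  where
  open ≡-Reasoning
  halves : ⌊ a /2⌋ ≡ ⌊ b /2⌋
  halves = bits-injective v ⌊ a /2⌋ ⌊ b /2⌋ (half-< v a a<) (half-< v b b<) (λ k k<v → same-bits (suc k) (s≤s k<v))

fromBits : ∀ {v} → Vec Bool v → ℕ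
fromBits [] = 0
fromBits (b ∷ bs) = toBit b + fromBits bs * 2

fromBits-< : ∀ {v} (bs : Vec Bool v) → fromBits bs < 2 ^ v
fromBits-< [] = s≤s z≤n
fromBits-< {suc v} (b ∷ bs) = ≤-trans (bit+double-< b (fromBits bs) (2 ^ v) (fromBits-< bs)) (≤-reflexive (sym (2^-suc v)))

bit-fromBits : ∀ {v} (bs : Vec Bool v) (k : Fin v) → bit (toℕ k) (fromBits bs) ≡ lookup bs k
bit-fromBits (b ∷ bs) zero = oddb-bit+double b (fromBits bs)
bit-fromBits (b ∷ bs) (suc k) = trans (cong (bit (toℕ k)) (half-bit+double b (fromBits bs))) (bit-fromBits bs k)

bits-surjective : ∀ {v} (bs : Vec Bool v) → ∃ λ (j : Fin (2 ^ v)) → ∀ (k : Fin v) → bit (toℕ k) (toℕ j) ≡ lookup bs k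
bits-surjective bs = fromℕ< (fromBits-< bs) , λ k →
  trans (cong (bit (toℕ k)) (toℕ-fromℕ< (fromBits-< bs))) (bit-fromBits bs k)

-- Two-level Kripke models

infixr 5 _⇒ᵇ_
_⇒ᵇ_ : Bool → Bool → Bool
a ⇒ᵇ b = not a ∨ b

⇒ᵇ-mp : ∀ {a b} → a ⇒ᵇ b ≡ true → a ≡ true → b ≡ true
⇒ᵇ-mp a⇒b refl = a⇒b

⇒ᵇ-intro : ∀ {a b} → (a ≡ true → b ≡ true) → a ⇒ᵇ b ≡ true
⇒ᵇ-intro {true} a→b = a→b refl
⇒ᵇ-intro {false} _ = refl

⇒ᵇ-false : ∀ a b → a ⇒ᵇ b ≡ false → a ≡ true × b ≡ false
⇒ᵇ-false true false refl = refl , refl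

≡-from-⇒ᵇ : ∀ {a b} → (a ≡ true → b ≡ true) → (b ≡ true → a ≡ true) → a ≡ b
≡-from-⇒ᵇ {true} a→b _ = sym (a→b refl)
≡-from-⇒ᵇ {false} {true} _ b→a = b→a refl
≡-from-⇒ᵇ {false} {false} _ _ = refl

ax1-valid : ∀ a b → a ⇒ᵇ b ⇒ᵇ a ≡ true
ax1-valid true b = ∨-zeroʳ (not b)
ax1-valid false b = refl

ax2-valid : ∀ a b c → (a ⇒ᵇ b ⇒ᵇ c) ⇒ᵇ (a ⇒ᵇ b) ⇒ᵇ a ⇒ᵇ c ≡ true
ax2-valid true true true = refl
ax2-valid true true false = refl
ax2-valid true false c = refl
ax2-valid false b c = refl

ax3-valid : ∀ a → ((a ⇒ᵇ false) ⇒ᵇ false) ⇒ᵇ a ≡ true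
ax3-valid true = refl
ax3-valid false = refl

∀ᵇ : ∀ {m} → (Fin m → Bool) → Bool
∀ᵇ {zero} P = true
∀ᵇ {suc m} P = P zero ∧ ∀ᵇ (P ∘ suc)

∀ᵇ-intro : ∀ {m} {P : Fin m → Bool} → (∀ i → P i ≡ true) → ∀ᵇ P ≡ true
∀ᵇ-intro {zero} h = refl
∀ᵇ-intro {suc m} h rewrite h zero = ∀ᵇ-intro (h ∘ suc)

∀ᵇ-elim : ∀ {m} {P : Fin m → Bool} → ∀ᵇ P ≡ true → ∀ i → P i ≡ true
∀ᵇ-elim {suc m} {P} h i with P zero in P0
∀ᵇ-elim h zero | true = P0
∀ᵇ-elim h (suc i) | true = ∀ᵇ-elim h i

∀ᵇ-false : ∀ {m} {P : Fin m → Bool} i → P i ≡ false → ∀ᵇ P ≡ false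
∀ᵇ-false {suc m} zero Pi rewrite Pi = refl
∀ᵇ-false {suc m} {P} (suc i) Pi rewrite ∀ᵇ-false {P = P ∘ suc} i Pi = ∧-zeroʳ (P zero)

∀ᵇ-counterexample : ∀ {m} {P : Fin m → Bool} → ∀ᵇ P ≡ false → ∃ λ i → P i ≡ false
∀ᵇ-counterexample {suc m} {P} h with P zero in P0
... | false = zero , P0
... | true = let i , Pi = ∀ᵇ-counterexample h in suc i , Pi

∀ᵇ-cong : ∀ {m} {P Q : Fin m → Bool} → (∀ i → P i ≡ Q i) → ∀ᵇ P ≡ ∀ᵇ Q
∀ᵇ-cong {zero} h = refl
∀ᵇ-cong {suc m} h = cong₂ _∧_ (h zero) (∀ᵇ-cong (h ∘ suc))

axK-valid : ∀ {m} (R P Q : Fin m → Bool) →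
  ∀ᵇ (λ i → R i ⇒ᵇ P i ⇒ᵇ Q i) ⇒ᵇ ∀ᵇ (λ i → R i ⇒ᵇ P i) ⇒ᵇ ∀ᵇ (λ i → R i ⇒ᵇ Q i) ≡ true
axK-valid R P Q =
  ⇒ᵇ-intro {∀ᵇ (λ i → R i ⇒ᵇ P i ⇒ᵇ Q i)} λ □P⇒Q → ⇒ᵇ-intro {∀ᵇ (λ i → R i ⇒ᵇ P i)} λ □P →
  ∀ᵇ-intro {P = λ i → R i ⇒ᵇ Q i} λ i → ⇒ᵇ-intro {R i} λ Ri →
  ⇒ᵇ-mp (⇒ᵇ-mp (∀ᵇ-elim □P⇒Q i) Ri) (⇒ᵇ-mp (∀ᵇ-elim □P i) Ri)

⟦_⟧₀ : Form → (ℕ → Bool) → Bool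
⟦ var k ⟧₀ ρ = ρ k
⟦ ⊥' ⟧₀ ρ = false
⟦ φ ⇒ ψ ⟧₀ ρ = ⟦ φ ⟧₀ ρ ⇒ᵇ ⟦ ψ ⟧₀ ρ
⟦ □ φ ⟧₀ ρ = true

-- A root that sees the leaves i with access i; leaves are dead ends, evaluated by ⟦_⟧₀.
record Model (m : ℕ) : Set where
  constructor model
  field
    access  : Fin m → Bool
    rootVal : ℕ → Bool
    leafVal : Fin m → ℕ → Bool
open Model

⟦_⟧ : ∀ {m} → Form → Model m → Bool
⟦ var k ⟧ M = rootVal M k
⟦ ⊥' ⟧ M = false
⟦ φ ⇒ ψ ⟧ M = ⟦ φ ⟧ M ⇒ᵇ ⟦ ψ ⟧ M
⟦ □ φ ⟧ M = ∀ᵇ λ i → access M i ⇒ᵇ ⟦ φ ⟧₀ (leafVal M i)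

sound₀ : ∀ {φ} → K⊢ φ → ∀ ρ → ⟦ φ ⟧₀ ρ ≡ true
sound₀ (ax1 φ ψ) ρ = ax1-valid (⟦ φ ⟧₀ ρ) (⟦ ψ ⟧₀ ρ)
sound₀ (ax2 φ ψ χ) ρ = ax2-valid (⟦ φ ⟧₀ ρ) (⟦ ψ ⟧₀ ρ) (⟦ χ ⟧₀ ρ)
sound₀ (ax3 φ) ρ = ax3-valid (⟦ φ ⟧₀ ρ)
sound₀ (axK φ ψ) ρ = refl
sound₀ (mp p q) ρ = ⇒ᵇ-mp (sound₀ p ρ) (sound₀ q ρ)
sound₀ (nec p) ρ = refl

sound : ∀ {m φ} → K⊢ φ → ∀ (M : Model m) → ⟦ φ ⟧ M ≡ true
sound (ax1 φ ψ) M = ax1-valid (⟦ φ ⟧ M) (⟦ ψ ⟧ M)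
sound (ax2 φ ψ χ) M = ax2-valid (⟦ φ ⟧ M) (⟦ ψ ⟧ M) (⟦ χ ⟧ M)
sound (ax3 φ) M = ax3-valid (⟦ φ ⟧ M)
sound (axK φ ψ) M = axK-valid (access M) (λ i → ⟦ φ ⟧₀ (leafVal M i)) (λ i → ⟦ ψ ⟧₀ (leafVal M i))
sound (mp p q) M = ⇒ᵇ-mp (sound p M) (sound q M)
sound (nec {φ} p) M = ∀ᵇ-intro λ i → trans (cong (access M i ⇒ᵇ_) (sound₀ p (leafVal M i))) (∨-zeroʳ _)

⟦⟧-deg0 : ∀ {m} (M : Model m) φ → deg φ ≤ 0 → ⟦ φ ⟧ M ≡ ⟦ φ ⟧₀ (rootVal M)
⟦⟧-deg0 M (var k) _ = refl
⟦⟧-deg0 M ⊥' _ = refl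
⟦⟧-deg0 M (φ ⇒ ψ) d =
  cong₂ _⇒ᵇ_ (⟦⟧-deg0 M φ (m⊔n≤o⇒m≤o (deg φ) (deg ψ) d)) (⟦⟧-deg0 M ψ (m⊔n≤o⇒n≤o (deg φ) (deg ψ) d))

⟦sub⟧₀ : ∀ σ ρ ρ′ → (∀ k → ⟦ σ k ⟧₀ ρ ≡ ρ′ k) → ∀ φ → ⟦ sub σ φ ⟧₀ ρ ≡ ⟦ φ ⟧₀ ρ′
⟦sub⟧₀ σ ρ ρ′ σρ (var k) = σρ k
⟦sub⟧₀ σ ρ ρ′ σρ ⊥' = refl
⟦sub⟧₀ σ ρ ρ′ σρ (φ ⇒ ψ) = cong₂ _⇒ᵇ_ (⟦sub⟧₀ σ ρ ρ′ σρ φ) (⟦sub⟧₀ σ ρ ρ′ σρ ψ)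
⟦sub⟧₀ σ ρ ρ′ σρ (□ φ) = refl

⟦sub⟧ : ∀ {m} σ (M : Model m) ρ η → (∀ k → ⟦ σ k ⟧ M ≡ ρ k) → (∀ i k → ⟦ σ k ⟧₀ (leafVal M i) ≡ η i k) →
        ∀ φ → ⟦ sub σ φ ⟧ M ≡ ⟦ φ ⟧ (model (access M) ρ η)
⟦sub⟧ σ M ρ η σρ ση (var k) = σρ k
⟦sub⟧ σ M ρ η σρ ση ⊥' = refl
⟦sub⟧ σ M ρ η σρ ση (φ ⇒ ψ) = cong₂ _⇒ᵇ_ (⟦sub⟧ σ M ρ η σρ ση φ) (⟦sub⟧ σ M ρ η σρ ση ψ)
⟦sub⟧ σ M ρ η σρ ση (□ φ) =
  ∀ᵇ-cong λ i → cong (access M i ⇒ᵇ_) (⟦sub⟧₀ σ (leafVal M i) (η i) (ση i) φ)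

record MapsOnto {m m′} (g : Fin m → Fin m′) (A : Fin m → Bool) (B : Fin m′ → Bool) : Set where
  field
    into : ∀ j → A j ≡ true → B (g j) ≡ true
    onto : ∀ i → B i ≡ true → ∃ λ j → A j ≡ true × g j ≡ i

∀ᵇ-image : ∀ {m m′} {g : Fin m → Fin m′} {A B} → MapsOnto g A B → (P : Fin m′ → Bool) →
           ∀ᵇ (λ j → A j ⇒ᵇ P (g j)) ≡ ∀ᵇ (λ i → B i ⇒ᵇ P i)
∀ᵇ-image {g = g} {A} {B} g↠ P = ≡-from-⇒ᵇ
  (λ all-A → ∀ᵇ-intro {P = λ i → B i ⇒ᵇ P i} λ i → ⇒ᵇ-intro {B i} λ Bi →
     let j , Aj , gj≡i = MapsOnto.onto g↠ i Bi in subst (λ x → P x ≡ true) gj≡i (⇒ᵇ-mp (∀ᵇ-elim all-A j) Aj))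
  (λ all-B → ∀ᵇ-intro {P = λ j → A j ⇒ᵇ P (g j)} λ j → ⇒ᵇ-intro {A j} λ Aj → ⇒ᵇ-mp (∀ᵇ-elim all-B (g j)) (MapsOnto.into g↠ j Aj))

⟦⟧-image : ∀ {m m′} {g : Fin m → Fin m′} {A B} → MapsOnto g A B → ∀ ρ η φ →
           ⟦ φ ⟧ (model A ρ (η ∘ g)) ≡ ⟦ φ ⟧ (model B ρ η)
⟦⟧-image g↠ ρ η (var k) = refl
⟦⟧-image g↠ ρ η ⊥' = refl
⟦⟧-image g↠ ρ η (φ ⇒ ψ) = cong₂ _⇒ᵇ_ (⟦⟧-image g↠ ρ η φ) (⟦⟧-image g↠ ρ η ψ)
⟦⟧-image g↠ ρ η (□ φ) = ∀ᵇ-image g↠ (λ i → ⟦ φ ⟧₀ (η i))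

module Valuation (e : Form → Bool) (e-⇒ : ∀ φ ψ → e (φ ⇒ ψ) ≡ e φ ⇒ᵇ e ψ) (e-⊥ : e ⊥' ≡ false) where

  ⊤-true : e ⊤' ≡ true
  ⊤-true = trans (e-⇒ ⊥' ⊥') (cong (λ b → b ⇒ᵇ b) e-⊥)

  ¬-true : ∀ φ → e (¬' φ) ≡ not (e φ)
  ¬-true φ = trans (e-⇒ φ ⊥') (trans (cong (e φ ⇒ᵇ_) e-⊥) (∨-identityʳ _))

  ∧-true : ∀ φ ψ → e (φ ∧' ψ) ≡ e φ ∧ e ψ
  ∧-true φ ψ = begin
    e (¬' (φ ⇒ ¬' ψ))          ≡⟨ ¬-true (φ ⇒ ¬' ψ) ⟩
    not (e (φ ⇒ ¬' ψ))         ≡⟨ cong not (trans (e-⇒ φ (¬' ψ)) (cong (e φ ⇒ᵇ_) (¬-true ψ))) ⟩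
    not (not (e φ) ∨ not (e ψ)) ≡⟨ not-nand (e φ) (e ψ) ⟩
    e φ ∧ e ψ                  ∎
    where
    open ≡-Reasoning
    not-nand : ∀ a b → not (not a ∨ not b) ≡ a ∧ b
    not-nand true b = not-involutive b
    not-nand false b = refl

  ⋀-true : ∀ {L} → All (λ φ → e φ ≡ true) L → e (⋀ L) ≡ true
  ⋀-true [] = ⊤-true
  ⋀-true {φ ∷ L} (p ∷ ps) = trans (∧-true φ (⋀ L)) (cong₂ _∧_ p (⋀-true ps))

  ⋀-elim-true : ∀ {L φ} → e (⋀ L) ≡ true → φ ∈ L → e φ ≡ true
  ⋀-elim-true {ψ ∷ L} ⋀L (here refl) = ∧-conicalˡ _ _ (trans (sym (∧-true ψ (⋀ L))) ⋀L)
  ⋀-elim-true {ψ ∷ L} ⋀L (there φ∈L) = ⋀-elim-true (∧-conicalʳ _ _ (trans (sym (∧-true ψ (⋀ L))) ⋀L)) φ∈L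

  ⋀-false : ∀ {L φ} → e φ ≡ false → φ ∈ L → e (⋀ L) ≡ false
  ⋀-false {L} {φ} eφ φ∈L with e (⋀ L) in e⋀
  ... | true = trans (sym (⋀-elim-true e⋀ φ∈L)) eφ
  ... | false = refl

  lit-true : ∀ b φ → e φ ≡ b → e (lit b φ) ≡ true
  lit-true true φ eφ = eφ
  lit-true false φ eφ = trans (¬-true φ) (cong not eφ)

  lit-true⁻ : ∀ b φ → e (lit b φ) ≡ true → e φ ≡ b
  lit-true⁻ true φ h = h
  lit-true⁻ false φ h with e φ | ¬-true φ
  ... | false | _ = refl
  ... | true | ¬φ = sym (trans (sym ¬φ) h)

module Valuation₀ (ρ : ℕ → Bool) = Valuation (λ φ → ⟦ φ ⟧₀ ρ) (λ _ _ → refl) refl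
module ValuationRoot {m} (M : Model m) = Valuation (λ φ → ⟦ φ ⟧ M) (λ _ _ → refl) refl

∈-allFin : ∀ {m} (i : Fin m) → i ∈ allFin m
∈-allFin zero = here refl
∈-allFin (suc i) = there (∈-map⁺ suc (∈-allFin i))

bits : ∀ {m} → Fin m → ℕ → Bool
bits j k = bit k (toℕ j)

literal : ∀ {m} → Fin m → ℕ → Form
literal i k = lit (bits i k) (var k)

minterm-literals : (v : ℕ) → Fin (2 ^ v) → List Form
minterm-literals v i = map (λ k → literal i (toℕ k)) (allFin v)

literal∈minterm : ∀ {v} (i : Fin (2 ^ v)) (k : Fin v) → literal i (toℕ k) ∈ minterm-literals v i
literal∈minterm i k = ∈-map⁺ (λ k → literal i (toℕ k)) (∈-allFin k)

minterm-holds : ∀ v i → ⟦ mtm v i ⟧₀ (bits i) ≡ true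
minterm-holds v i = Valuation₀.⋀-true (bits i)
  (map⁺ (universal (λ k → Valuation₀.lit-true (bits i) (bits i (toℕ k)) (var (toℕ k)) refl) (allFin v)))

minterm-unique : ∀ v i j → ⟦ mtm v i ⟧₀ (bits j) ≡ true → i ≡ j
minterm-unique v i j mᵢ = toℕ-injective (bits-injective v (toℕ i) (toℕ j) (toℕ<n i) (toℕ<n j) same-bits)
  where
  same-bits : ∀ k → k < v → bit k (toℕ i) ≡ bit k (toℕ j)
  same-bits k k<v = subst (λ x → bits i x ≡ bits j x) (toℕ-fromℕ< k<v)
    (sym (Valuation₀.lit-true⁻ (bits j) _ _ (Valuation₀.⋀-elim-true (bits j) mᵢ (literal∈minterm i (fromℕ< k<v)))))

-- "f i, where m_i is the minterm that holds"
byMinterms : (v : ℕ) → (Fin (2 ^ v) → Form) → Form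
byMinterms v f = ⋀ (map (λ i → mtm v i ⇒ f i) (allFin (2 ^ v)))

⟦byMinterms⟧ : ∀ v f j → ⟦ byMinterms v f ⟧₀ (bits j) ≡ ⟦ f j ⟧₀ (bits j)
⟦byMinterms⟧ v f j with ⟦ f j ⟧₀ (bits j) in fⱼ
... | true = Valuation₀.⋀-true (bits j) (map⁺ (universal case (allFin (2 ^ v))))
  where
  case : ∀ i → ⟦ mtm v i ⇒ f i ⟧₀ (bits j) ≡ true
  case i = ⇒ᵇ-intro {⟦ mtm v i ⟧₀ (bits j)} λ mᵢ →
    subst (λ x → ⟦ f x ⟧₀ (bits j) ≡ true) (sym (minterm-unique v i j mᵢ)) fⱼ
... | false = Valuation₀.⋀-false (bits j) case-j (∈-map⁺ (λ i → mtm v i ⇒ f i) (∈-allFin j))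
  where
  case-j : ⟦ mtm v j ⇒ f j ⟧₀ (bits j) ≡ false
  case-j rewrite minterm-holds v j | fⱼ = refl

indicator : (v : ℕ) → (Fin (2 ^ v) → Bool) → Form
indicator v h = byMinterms v (λ i → lit (h i) ⊤')

⟦indicator⟧ : ∀ v h j → ⟦ indicator v h ⟧₀ (bits j) ≡ h j
⟦indicator⟧ v h j = trans (⟦byMinterms⟧ v _ j) (⟦lit⊤⟧ (h j))
  where
  ⟦lit⊤⟧ : ∀ b → ⟦ lit b ⊤' ⟧₀ (bits j) ≡ b
  ⟦lit⊤⟧ true = refl
  ⟦lit⊤⟧ false = refl

deg-⇒ : ∀ φ ψ → deg φ ≤ 0 → deg ψ ≤ 0 → deg (φ ⇒ ψ) ≤ 0
deg-⇒ φ ψ = ⊔-lub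

deg-¬ : ∀ φ → deg φ ≤ 0 → deg (¬' φ) ≤ 0
deg-¬ φ d = deg-⇒ φ ⊥' d z≤n

deg-⋀ : ∀ L → All (λ φ → deg φ ≤ 0) L → deg (⋀ L) ≤ 0
deg-⋀ [] [] = z≤n
deg-⋀ (φ ∷ L) (d ∷ ds) = deg-¬ (φ ⇒ ¬' (⋀ L)) (deg-⇒ φ (¬' (⋀ L)) d (deg-¬ (⋀ L) (deg-⋀ L ds)))

deg-lit : ∀ b φ → deg φ ≤ 0 → deg (lit b φ) ≤ 0
deg-lit true φ d = d
deg-lit false φ d = deg-¬ φ d

deg-mtm : ∀ v i → deg (mtm v i) ≤ 0
deg-mtm v i = deg-⋀ (minterm-literals v i) (map⁺ (universal (λ k → deg-lit (bits i (toℕ k)) (var (toℕ k)) z≤n) (allFin v)))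

deg-indicator : ∀ v h → deg (indicator v h) ≤ 0
deg-indicator v h = deg-⋀ _ (map⁺ (universal
  (λ i → deg-⇒ (mtm v i) (lit (h i) ⊤') (deg-mtm v i) (deg-lit (h i) ⊤' z≤n)) (allFin (2 ^ v))))

deg-sub : ∀ σ → (∀ k → deg (σ k) ≤ 0) → ∀ φ → deg (sub σ φ) ≤ deg φ
deg-sub σ d (var k) = d k
deg-sub σ d ⊥' = z≤n
deg-sub σ d (φ ⇒ ψ) = ⊔-mono-≤ (deg-sub σ d φ) (deg-sub σ d ψ)
deg-sub σ d (□ φ) = s≤s (deg-sub σ d φ)

InLang-¬ : ∀ {v φ} → InLang v φ → InLang v (¬' φ)
InLang-¬ p = p ⇒ ⊥'

InLang-⋀ : ∀ {v L} → All (InLang v) L → InLang v (⋀ L)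
InLang-⋀ [] = InLang-¬ ⊥'
InLang-⋀ (p ∷ ps) = InLang-¬ (p ⇒ InLang-¬ (InLang-⋀ ps))

InLang-lit : ∀ {v} b {φ} → InLang v φ → InLang v (lit b φ)
InLang-lit true p = p
InLang-lit false p = InLang-¬ p

InLang-mtm : ∀ v i → InLang v (mtm v i)
InLang-mtm v i = InLang-⋀ (map⁺ (universal (λ k → InLang-lit _ (var (toℕ<n k))) (allFin v)))

InLang-indicator : ∀ v h → InLang v (indicator v h)
InLang-indicator v h =
  InLang-⋀ (map⁺ (universal (λ i → InLang-mtm v i ⇒ InLang-lit (h i) (InLang-¬ ⊥')) (allFin (2 ^ v))))

InLang-sub : ∀ {v} σ → (∀ k → InLang v (σ k)) → ∀ {φ} → InLang v φ → InLang v (sub σ φ)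
InLang-sub σ h (var {k} _) = h k
InLang-sub σ h ⊥' = ⊥'
InLang-sub σ h (p ⇒ q) = InLang-sub σ h p ⇒ InLang-sub σ h q
InLang-sub σ h (□ p) = □ (InLang-sub σ h p)

-- Completeness of K at the atoms of K[v,1]

⊢lit-⇒ : ∀ {Γ φ ψ} a b → Γ ⊢ lit a φ → Γ ⊢ lit b ψ → Γ ⊢ lit (a ⇒ᵇ b) (φ ⇒ ψ)
⊢lit-⇒ false b ¬φ _ = ⇒-intro (explode (⇒-elim (weaken ¬φ) #0))
⊢lit-⇒ true true _ ψ = ⇒-intro (weaken ψ)
⊢lit-⇒ true false φ ¬ψ = ⇒-intro (⇒-elim (weaken ¬ψ) (⇒-elim #0 (weaken φ)))

minterm⊢literal : ∀ {Γ v} {i : Fin (2 ^ v)} {k} → k < v → Γ ⊢ mtm v i → Γ ⊢ literal i k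
minterm⊢literal {Γ} {i = i} k<v mᵢ =
  subst (λ x → Γ ⊢ literal i x) (toℕ-fromℕ< k<v) (⋀-elim (literal∈minterm i (fromℕ< k<v)) mᵢ)

minterm⊢lit : ∀ {Γ v} {i : Fin (2 ^ v)} {ψ} → InLang v ψ → deg ψ ≤ 0 → Γ ⊢ mtm v i → Γ ⊢ lit (⟦ ψ ⟧₀ (bits i)) ψ
minterm⊢lit (var k<v) _ mᵢ = minterm⊢literal k<v mᵢ
minterm⊢lit ⊥' _ _ = theorem (K⊢-id ⊥')
minterm⊢lit {i = i} {φ ⇒ ψ} (p ⇒ q) d mᵢ = ⊢lit-⇒ (⟦ φ ⟧₀ (bits i)) (⟦ ψ ⟧₀ (bits i))
  (minterm⊢lit p (m⊔n≤o⇒m≤o (deg φ) (deg ψ) d) mᵢ) (minterm⊢lit q (m⊔n≤o⇒n≤o (deg φ) (deg ψ) d) mᵢ)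

literals : ∀ {r} → Vec ℕ r → Vec Bool r → List Form
literals [] [] = []
literals (k ∷ ks) (b ∷ bs) = lit b (var k) ∷ literals ks bs

by-cases-on-literals : ∀ {r} (ks : Vec ℕ r) {Δ φ} → (∀ bs → literals ks bs ++ Δ ⊢ φ) → Δ ⊢ φ
by-cases-on-literals [] h = h []
by-cases-on-literals (k ∷ ks) h =
  by-cases-on-literals ks λ bs → excluded-middle (⇒-intro (h (true ∷ bs))) (⇒-intro (h (false ∷ bs)))

lit∈literals : ∀ {r} (g : Fin r → ℕ) bs k → lit (lookup bs k) (var (g k)) ∈ literals (tabulate g) bs
lit∈literals g (b ∷ bs) zero = here refl
lit∈literals g (b ∷ bs) (suc k) = there (lit∈literals (g ∘ suc) bs k)

minterms-exhaustive : ∀ v ψ → K⊢ (byMinterms v (λ _ → ψ) ⇒ ψ)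
minterms-exhaustive v ψ = discharged (by-cases-on-literals (tabulate toℕ) case)
  where
  case : ∀ bs → literals (tabulate toℕ) bs ++ byMinterms v (λ _ → ψ) ∷ [] ⊢ ψ
  case bs = ⇒-elim (⋀-elim (∈-map⁺ (λ i → mtm v i ⇒ ψ) (∈-allFin j)) (assumption (∈-++⁺ʳ _ (here refl))))
                   (⋀-intro (map⁺ (universal literal-holds (allFin v))))
    where
    j = proj₁ (bits-surjective bs)
    literal-holds : ∀ k → literals (tabulate toℕ) bs ++ byMinterms v (λ _ → ψ) ∷ [] ⊢ literal j (toℕ k)
    literal-holds k = subst (λ b → _ ⊢ lit b (var (toℕ k))) (sym (proj₂ (bits-surjective bs) k))
                            (assumption (∈-++⁺ˡ (lit∈literals toℕ bs k)))

canonical : (v : ℕ) → Atom v → Model (2 ^ v)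
canonical v (s , ε) = model ε (bits s) bits

module AtomDerivations {v : ℕ} (s : Fin (2 ^ v)) (ε : Fin (2 ^ v) → Bool) where

  private
    Γ : List Form
    Γ = atomF v (s , ε) ∷ []

  atom⊢◇ : ∀ i → Γ ⊢ lit (ε i) (◇ (mtm v i))
  atom⊢◇ i = ⋀-elim (∈-map⁺ (λ i → lit (ε i) (◇ (mtm v i))) (∈-allFin i)) (∧-elim₂ #0)

  atom⊢□-minterm : ∀ {ψ} → InLang v ψ → deg ψ ≤ 0 → ∀ i → ε i ⇒ᵇ ⟦ ψ ⟧₀ (bits i) ≡ true → Γ ⊢ □ (mtm v i ⇒ ψ)
  atom⊢□-minterm {ψ} p d i ψᵢ with ε i | atom⊢◇ i
  ... | true | _ = □-nec (discharged (subst (λ b → mtm v i ∷ [] ⊢ lit b ψ) ψᵢ (minterm⊢lit p d #0)))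
  ... | false | ¬◇mᵢ =
    □-mp (□-nec (closed (⇒-intro (⇒-intro (explode (⇒-elim #1 #0)))))) (⇒-elim (theorem (ax3 (□ (¬' (mtm v i))))) ¬◇mᵢ)

  atom⊢□ : ∀ {ψ} → InLang v ψ → deg ψ ≤ 0 → ⟦ □ ψ ⟧ (canonical v (s , ε)) ≡ true → Γ ⊢ □ ψ
  atom⊢□ {ψ} p d □ψ = □-mp (□-nec (minterms-exhaustive v ψ))
    (□-⋀-intro (map⁺ (universal (λ i → atom⊢□-minterm p d i (∀ᵇ-elim □ψ i)) (allFin (2 ^ v)))))

  atom⊢¬□ : ∀ {ψ} → InLang v ψ → deg ψ ≤ 0 → ⟦ □ ψ ⟧ (canonical v (s , ε)) ≡ false → Γ ⊢ ¬' (□ ψ)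
  atom⊢¬□ {ψ} p d ¬□ψ = ⇒-intro (⇒-elim (weaken ◇mᵢ) (□-mp (□-nec ψ⇒¬mᵢ) #0))
    where
    counterexample = ∀ᵇ-counterexample {P = λ i → ε i ⇒ᵇ ⟦ ψ ⟧₀ (bits i)} ¬□ψ
    i = proj₁ counterexample
    εᵢ,¬ψᵢ = ⇒ᵇ-false (ε i) (⟦ ψ ⟧₀ (bits i)) (proj₂ counterexample)
    ◇mᵢ : Γ ⊢ ◇ (mtm v i)
    ◇mᵢ = subst (λ b → Γ ⊢ lit b (◇ (mtm v i))) (proj₁ εᵢ,¬ψᵢ) (atom⊢◇ i)
    mᵢ⇒¬ψ : K⊢ (mtm v i ⇒ ¬' ψ)
    mᵢ⇒¬ψ = discharged (subst (λ b → mtm v i ∷ [] ⊢ lit b ψ) (proj₂ εᵢ,¬ψᵢ) (minterm⊢lit p d #0))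
    ψ⇒¬mᵢ : K⊢ (ψ ⇒ ¬' (mtm v i))
    ψ⇒¬mᵢ = closed (⇒-intro (⇒-intro (⇒-elim (⇒-elim (theorem mᵢ⇒¬ψ) #0) #1)))

  atom⊢lit : ∀ {φ} → InLang v φ → deg φ ≤ 1 → Γ ⊢ lit (⟦ φ ⟧ (canonical v (s , ε))) φ
  atom⊢lit (var k<v) _ = minterm⊢literal k<v (∧-elim₁ #0)
  atom⊢lit ⊥' _ = theorem (K⊢-id ⊥')
  atom⊢lit {φ ⇒ ψ} (p ⇒ q) d = ⊢lit-⇒ (⟦ φ ⟧ (canonical v (s , ε))) (⟦ ψ ⟧ (canonical v (s , ε)))
    (atom⊢lit p (m⊔n≤o⇒m≤o (deg φ) (deg ψ) d)) (atom⊢lit q (m⊔n≤o⇒n≤o (deg φ) (deg ψ) d))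
  atom⊢lit {□ ψ} (□ p) (s≤s d) with ⟦ □ ψ ⟧ (canonical v (s , ε)) in □ψ
  ... | true = atom⊢□ p d □ψ
  ... | false = atom⊢¬□ p d □ψ

atom-complete : ∀ v (a : Atom v) {φ} → InLang v φ → deg φ ≤ 1 → ⟦ φ ⟧ (canonical v a) ≡ true → below v φ a
atom-complete v (s , ε) {φ} p d φ-true =
  discharged (subst (λ b → atomF v (s , ε) ∷ [] ⊢ lit b φ) φ-true (AtomDerivations.atom⊢lit s ε p d))

⟦◇minterm⟧ : ∀ v s ε i → ⟦ ◇ (mtm v i) ⟧ (canonical v (s , ε)) ≡ ε i
⟦◇minterm⟧ v s ε i =
  trans (ValuationRoot.¬-true (canonical v (s , ε)) (□ (¬' (mtm v i))))
        (trans (cong not (⟦□¬minterm⟧ (ε i) refl)) (not-involutive (ε i)))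
  where
  ⟦□¬minterm⟧ : ∀ b → ε i ≡ b → ⟦ □ (¬' (mtm v i)) ⟧ (canonical v (s , ε)) ≡ not b
  ⟦□¬minterm⟧ true εᵢ = ∀ᵇ-false i (subst (λ b → b ⇒ᵇ (⟦ mtm v i ⟧₀ (bits i) ⇒ᵇ false) ≡ false) (sym εᵢ)
                                       (cong (λ b → b ⇒ᵇ false) (minterm-holds v i)))
  ⟦□¬minterm⟧ false εᵢ = ∀ᵇ-intro λ j → ⇒ᵇ-intro {ε j} λ εⱼ → ¬mᵢ j εⱼ
    where
    ¬mᵢ : ∀ j → ε j ≡ true → ⟦ mtm v i ⟧₀ (bits j) ⇒ᵇ false ≡ true
    ¬mᵢ j εⱼ with ⟦ mtm v i ⟧₀ (bits j) in mᵢ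
    ... | false = refl
    ... | true = trans (sym εᵢ) (trans (cong ε (minterm-unique v i j mᵢ)) εⱼ)

atom-holds : ∀ v (a : Atom v) → ⟦ atomF v a ⟧ (canonical v a) ≡ true
atom-holds v (s , ε) = trans (V.∧-true (mtm v s) (⋀ diamond-literals)) (cong₂ _∧_ root-minterm diamonds)
  where
  module V = ValuationRoot (canonical v (s , ε))
  root-minterm : ⟦ mtm v s ⟧ (canonical v (s , ε)) ≡ true
  root-minterm = trans (⟦⟧-deg0 (canonical v (s , ε)) (mtm v s) (deg-mtm v s)) (minterm-holds v s)
  diamond-literals : List Form
  diamond-literals = map (λ i → lit (ε i) (◇ (mtm v i))) (allFin (2 ^ v))
  diamonds : ⟦ ⋀ diamond-literals ⟧ (canonical v (s , ε)) ≡ true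
  diamonds = V.⋀-true (map⁺ (universal (λ i → V.lit-true (ε i) (◇ (mtm v i)) (⟦◇minterm⟧ v s ε i)) (allFin (2 ^ v))))

true≢false : true ≢ false
true≢false ()

_⊆ᵇ_ : ∀ {m} → (Fin m → Bool) → (Fin m → Bool) → Set
A ⊆ᵇ B = ∀ i → A i ≡ true → B i ≡ true

count-cong : ∀ {m} {f g : Fin m → Bool} → (∀ i → f i ≡ g i) → count f ≡ count g
count-cong {zero} h = refl
count-cong {suc m} h = cong₂ (λ b n → (if b then 1 else 0) + n) (h zero) (count-cong (h ∘ suc))

count-false : ∀ m → count {m} (λ _ → false) ≡ 0
count-false zero = refl
count-false (suc m) = count-false m

count-true : ∀ m → count {m} (λ _ → true) ≡ m
count-true zero = refl
count-true (suc m) = cong suc (count-true m)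

count≡0 : ∀ {m} (f : Fin m → Bool) → count f ≡ 0 → ∀ i → f i ≡ false
count≡0 {suc m} f c≡0 i with f zero in f₀
count≡0 {suc m} f c≡0 zero | false = f₀
count≡0 {suc m} f c≡0 (suc i) | false = count≡0 (f ∘ suc) c≡0 i

count-witness : ∀ {m} (f : Fin m → Bool) → 1 ≤ count f → ∃ λ i → f i ≡ true
count-witness {suc m} f c≥1 with f zero in f₀
... | true = zero , f₀
... | false = let i , fᵢ = count-witness (f ∘ suc) c≥1 in suc i , fᵢ

count-<-witness : ∀ {m} (f g : Fin m → Bool) → count f < count g → ∃ λ i → g i ≡ true × f i ≡ false
count-<-witness {suc m} f g c< with f zero in f₀ | g zero in g₀
... | false | true = zero , g₀ , f₀
... | false | false = let i , gᵢ , fᵢ = count-<-witness (f ∘ suc) (g ∘ suc) c< in suc i , gᵢ , fᵢ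
... | true | true = let i , gᵢ , fᵢ = count-<-witness (f ∘ suc) (g ∘ suc) (s≤s⁻¹ c<) in suc i , gᵢ , fᵢ
... | true | false = let i , gᵢ , fᵢ = count-<-witness (f ∘ suc) (g ∘ suc) (≤-trans (s≤s (n≤1+n _)) c<) in suc i , gᵢ , fᵢ

count-suc : ∀ {m} {f g : Fin m → Bool} i → f i ≡ false → g i ≡ true → (∀ j → j ≢ i → g j ≡ f j) →
            count g ≡ suc (count f)
count-suc {f = f} {g} zero f₀ g₀ elsewhere rewrite f₀ | g₀ =
  cong suc (count-cong λ j → elsewhere (suc j) λ ())
count-suc {f = f} {g} (suc i) fᵢ gᵢ elsewhere rewrite elsewhere zero (λ ()) =
  trans (cong ((if f zero then 1 else 0) +_) (count-suc i fᵢ gᵢ (λ j j≢i → elsewhere (suc j) (j≢i ∘ suc-injective))))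
        (+-suc _ _)

others : ∀ {m} → Fin m → (Fin m → Bool) → Fin m → Bool
others s ε i = ε i ∧ not (does (i ≟ s))

others-self : ∀ {m} (s : Fin m) ε → others s ε s ≡ false
others-self s ε rewrite dec-true (s ≟ s) refl = ∧-zeroʳ (ε s)

others-≢ : ∀ {m} {s i : Fin m} ε → i ≢ s → others s ε i ≡ ε i
others-≢ {s = s} {i} ε i≢s rewrite dec-false (i ≟ s) i≢s = ∧-identityʳ (ε i)

count-root-true : ∀ {m} (s : Fin m) ε → ε s ≡ true → count ε ≡ suc (othersOn s ε)
count-root-true s ε εₛ = count-suc s (others-self s ε) εₛ (λ j j≢s → sym (others-≢ ε j≢s))

count-root-false : ∀ {m} (s : Fin m) ε → ε s ≡ false → count ε ≡ othersOn s ε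
count-root-false s ε εₛ = count-cong λ i → case i
  where
  case : ∀ i → ε i ≡ others s ε i
  case i with i ≟ s
  ... | yes refl = trans εₛ (sym (∧-zeroʳ (ε i)))
  ... | no _ = sym (∧-identityʳ (ε i))

othersOn-only-root : ∀ {m} (s : Fin m) ε → (∀ i → i ≢ s → ε i ≡ false) → othersOn s ε ≡ 0
othersOn-only-root {m} s ε only-s = trans (count-cong none) (count-false m)
  where
  none : ∀ i → others s ε i ≡ false
  none i with i ≟ s
  ... | yes refl = ∧-zeroʳ (ε i)
  ... | no i≢s = trans (∧-identityʳ (ε i)) (only-s i i≢s)

non-roots : ∀ {m} (s : Fin m) → suc (count (λ i → not (does (i ≟ s)))) ≡ m
non-roots {m} s = trans (sym (count-root-true s (λ _ → true) refl)) (count-true m)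

insert : ∀ {m} → Fin m → (Fin m → Bool) → Fin m → Bool
insert i B j = B j ∨ does (j ≟ i)

⊆-insert : ∀ {m} (i : Fin m) B → B ⊆ᵇ insert i B
⊆-insert i B j Bⱼ rewrite Bⱼ = refl

insert-≢ : ∀ {m} {i j : Fin m} B → j ≢ i → insert i B j ≡ B j
insert-≢ {i = i} {j} B j≢i rewrite dec-false (j ≟ i) j≢i = ∨-identityʳ (B j)

othersOn-insert : ∀ {m} {i s : Fin m} B → i ≢ s → B i ≡ false → othersOn s (insert i B) ≡ suc (othersOn s B)
othersOn-insert {i = i} {s} B i≢s Bᵢ = count-suc i (trans (others-≢ B i≢s) Bᵢ) inserted unchanged
  where
  inserted : others s (insert i B) i ≡ true
  inserted rewrite others-≢ (insert i B) i≢s | dec-true (i ≟ i) refl = ∨-zeroʳ (B i)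
  unchanged : ∀ j → j ≢ i → others s (insert i B) j ≡ others s B j
  unchanged j j≢i = cong (_∧ not (does (j ≟ s))) (insert-≢ B j≢i)

extend : ∀ {m} (t : Fin m) (B : Fin m → Bool) {k} → othersOn t B ≤ k → k < m →
         ∃ λ A → B ⊆ᵇ A × A t ≡ B t × othersOn t A ≡ k
extend {m} t B {k} o≤k k<m = grow (k ∸ othersOn t B) B (m∸n+n≡m o≤k)
  where
  grow : ∀ d B → d + othersOn t B ≡ k → ∃ λ A → B ⊆ᵇ A × A t ≡ B t × othersOn t A ≡ k
  grow zero B refl = B , (λ _ Bᵢ → Bᵢ) , refl , refl
  grow (suc d) B d+o≡k = A , (λ j → B′⊆A j ∘ ⊆-insert i B j) , trans Aₜ (insert-≢ B (i≢t ∘ sym)) , oA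
    where
    o<non-roots : othersOn t B < count (λ j → not (does (j ≟ t)))
    o<non-roots = s≤s⁻¹ (begin-strict
      suc (othersOn t B)  ≤⟨ s≤s (m≤n+m _ d) ⟩
      suc (d + othersOn t B) ≡⟨ d+o≡k ⟩
      k                   <⟨ k<m ⟩
      m                   ≡⟨ sym (non-roots t) ⟩
      suc (count (λ j → not (does (j ≟ t)))) ∎)
      where open ≤-Reasoning
    free = count-<-witness (others t B) (λ j → not (does (j ≟ t))) o<non-roots
    i = proj₁ free
    i≢t : i ≢ t
    i≢t i≡t = true≢false (trans (sym (proj₁ (proj₂ free))) (cong not (dec-true (i ≟ t) i≡t)))
    Bᵢ : B i ≡ false
    Bᵢ = trans (sym (others-≢ B i≢t)) (proj₂ (proj₂ free))
    grown = grow d (insert i B) (trans (cong (d +_) (othersOn-insert B i≢t Bᵢ)) (trans (+-suc d _) d+o≡k))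
    A = proj₁ grown
    B′⊆A = proj₁ (proj₂ grown)
    Aₜ = proj₁ (proj₂ (proj₂ grown))
    oA = proj₂ (proj₂ (proj₂ grown))

retraction : ∀ {m} → (Fin m → Bool) → (t s d : Fin m) → Fin m → Fin m
retraction B t s d i = if B i then i else (if does (i ≟ t) then s else d)

retraction-root : ∀ {m} B (t s d : Fin m) → (B t ≡ true → t ≡ s) → retraction B t s d t ≡ s
retraction-root B t s d Bₜ⇒t≡s with B t in Bₜ
... | true = Bₜ⇒t≡s refl
... | false rewrite dec-true (t ≟ t) refl = refl

retraction-maps-onto : ∀ {m} {A B : Fin m → Bool} {t s d} → B ⊆ᵇ A → B d ≡ true → (A t ≡ true → B s ≡ true) →
                       MapsOnto (retraction B t s d) A B
retraction-maps-onto {A = A} {B} {t} {s} {d} B⊆A B-d Aₜ⇒Bₛ = record { into = into ; onto = onto }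
  where
  into : ∀ j → A j ≡ true → B (retraction B t s d j) ≡ true
  into j Aⱼ with B j in Bⱼ | j ≟ t
  ... | true | _ = Bⱼ
  ... | false | yes refl = Aₜ⇒Bₛ Aⱼ
  ... | false | no _ = B-d
  onto : ∀ i → B i ≡ true → ∃ λ j → A j ≡ true × retraction B t s d j ≡ i
  onto i Bᵢ = i , B⊆A i Bᵢ , fixed
    where
    fixed : retraction B t s d i ≡ i
    fixed rewrite Bᵢ = refl

-- Characteristic minmatrices are closed under images of atoms

relabelling : (v : ℕ) → (Fin (2 ^ v) → Fin (2 ^ v)) → ℕ → Form
relabelling v g k = indicator v (λ j → bits (g j) k)

module _ {S : Form → Set} (S-normal : IsNormalLogic S) {v : ℕ} where

  private
    ξ : Atom v → Set
    ξ = ⟦⟦ S ⟧⟧ v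

  transfer : ∀ {t s A B} (g : Fin (2 ^ v) → Fin (2 ^ v)) → ξ (t , A) → MapsOnto g A B → g t ≡ s → ξ (s , B)
  transfer {t} {s} {A} {B} g ξ-tA g↠ gt≡s φ φ∈L dφ Sφ = atom-complete v (s , B) φ∈L dφ (begin
    ⟦ φ ⟧ (canonical v (s , B))          ≡⟨ sym (⟦⟧-image g↠ (bits s) bits φ) ⟩
    ⟦ φ ⟧ (model A (bits s) (bits ∘ g))  ≡⟨ sym (⟦sub⟧ σ (canonical v (t , A)) (bits s) (bits ∘ g) σ-root σ-leaf φ) ⟩
    ⟦ sub σ φ ⟧ (canonical v (t , A))    ≡⟨ ⇒ᵇ-mp (sound tA⊢σφ (canonical v (t , A))) (atom-holds v (t , A)) ⟩
    true                                 ∎)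
    where
    open ≡-Reasoning
    σ = relabelling v g
    tA⊢σφ : below v (sub σ φ) (t , A)
    tA⊢σφ = ξ-tA (sub σ φ) (InLang-sub σ (λ k → InLang-indicator v _) φ∈L)
                 (≤-trans (deg-sub σ (λ k → deg-indicator v _) φ) dφ) (IsNormalLogic.subS S-normal σ Sφ)
    σ-root : ∀ k → ⟦ σ k ⟧ (canonical v (t , A)) ≡ bits s k
    σ-root k = begin
      ⟦ σ k ⟧ (canonical v (t , A)) ≡⟨ ⟦⟧-deg0 (canonical v (t , A)) (σ k) (deg-indicator v _) ⟩
      ⟦ σ k ⟧₀ (bits t)             ≡⟨ ⟦indicator⟧ v _ t ⟩
      bits (g t) k                  ≡⟨ cong (λ x → bits x k) gt≡s ⟩
      bits s k                      ∎
    σ-leaf : ∀ i k → ⟦ σ k ⟧₀ (bits i) ≡ bits (g i) k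
    σ-leaf i k = ⟦indicator⟧ v _ i

  retract : ∀ {t s d A B} → ξ (t , A) → B ⊆ᵇ A → B d ≡ true → (B t ≡ true → t ≡ s) → (A t ≡ true → B s ≡ true) →
            ξ (s , B)
  retract {t} {s} {d} {A} {B} ξ-tA B⊆A B-d Bₜ⇒t≡s Aₜ⇒Bₛ =
    transfer (retraction B t s d) ξ-tA (retraction-maps-onto B⊆A B-d Aₜ⇒Bₛ) (retraction-root B t s d Bₜ⇒t≡s)

  Vv₀-included : ∀ {t A} → ξ (t , A) → (∀ j → A j ≡ false) → Incl v (Vv₀ v) ξ
  Vv₀-included {A = A} ξ-tA A-empty (s , B) B-empty = transfer (λ _ → s) ξ-tA constant refl
    where
    constant : MapsOnto (λ _ → s) A B
    constant = record
      { into = λ j Aⱼ → ⊥-elim (true≢false (trans (sym Aⱼ) (A-empty j)))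
      ; onto = λ i Bᵢ → ⊥-elim (true≢false (trans (sym Bᵢ) (B-empty i))) }

  Dd₀-included : ∀ {t A j} → ξ (t , A) → A j ≡ true → Incl v (Dd₀ v) ξ
  Dd₀-included {A = A} {j} ξ-tA Aⱼ (s , B) (Bₛ , B-only-s) = transfer (λ _ → s) ξ-tA constant refl
    where
    onto : ∀ i → B i ≡ true → ∃ λ j → A j ≡ true × s ≡ i
    onto i Bᵢ with i ≟ s
    ... | yes i≡s = j , Aⱼ , sym i≡s
    ... | no i≢s = ⊥-elim (true≢false (trans (sym Bᵢ) (B-only-s i i≢s)))
    constant : MapsOnto (λ _ → s) A B
    constant = record { into = λ _ _ → Bₛ ; onto = onto }

  Vv₀-or-Dd₀-included : ∃ ξ → Incl v (Vv₀ v) ξ ⊎ Incl v (Dd₀ v) ξ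
  Vv₀-or-Dd₀-included ((t , A) , ξ-tA) with count A in count-A
  ... | zero = inj₁ (Vv₀-included ξ-tA (count≡0 A count-A))
  ... | suc _ = inj₂ (Dd₀-included ξ-tA (proj₂ (count-witness A (≤-trans (s≤s z≤n) (≤-reflexive (sym count-A))))))

  included-below : ∀ {s B d k} → (∀ A → A s ≡ B s → othersOn s A ≡ k → ξ (s , A)) → k < 2 ^ v →
                   othersOn s B ≤ k → B d ≡ true → ξ (s , B)
  included-below {s} {B} ξₖ k<n o≤k B-d =
    retract (ξₖ A Aₛ oA) B⊆A B-d (λ _ → refl) (λ Aₛ′ → trans (sym Aₛ) Aₛ′)
    where
    extended = extend s B o≤k k<n
    A = proj₁ extended
    B⊆A = proj₁ (proj₂ extended)
    Aₛ = proj₁ (proj₂ (proj₂ extended))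
    oA = proj₂ (proj₂ (proj₂ extended))

  -- Below a reflexive root s, enlarge B at a fresh irreflexive root t and retract t onto s.
  included-below-irreflexive : ∀ {s B k} → Incl v (Dc v k) ξ → k < 2 ^ v → B s ≡ true → othersOn s B < k → ξ (s , B)
  included-below-irreflexive {s} {B} {k} Dcₖ k<n Bₛ o<k =
    retract (Dcₖ (t , A) (trans Aₜ Bₜ , oA)) B⊆A Bₛ (λ Bₜ′ → ⊥-elim (true≢false (trans (sym Bₜ′) Bₜ))) (λ _ → Bₛ)
    where
    count-B≤k : count B ≤ k
    count-B≤k = ≤-trans (≤-reflexive (count-root-true s B Bₛ)) o<k
    missing = count-<-witness B (λ _ → true) (≤-trans (s≤s count-B≤k) (≤-trans k<n (≤-reflexive (sym (count-true _)))))
    t = proj₁ missing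
    Bₜ = proj₂ (proj₂ missing)
    extended = extend t B (≤-trans (≤-reflexive (sym (count-root-false t B Bₜ))) count-B≤k) k<n
    A = proj₁ extended
    B⊆A = proj₁ (proj₂ extended)
    Aₜ = proj₁ (proj₂ (proj₂ extended))
    oA = proj₂ (proj₂ (proj₂ extended))

  Dw-included-below : ∀ {k l} → Incl v (Dw v k) ξ → k < 2 ^ v → l ≤ k → Incl v (Dw v l) ξ
  Dw-included-below Dwₖ k<n l≤k (s , B) (Bₛ , oB) =
    included-below (λ A Aₛ oA → Dwₖ (s , A) (trans Aₛ Bₛ , oA)) k<n (≤-trans (≤-reflexive oB) l≤k) Bₛ

  Dc-included-below : ∀ {k l} → Incl v (Dc v k) ξ → k < 2 ^ v → 1 ≤ l → l ≤ k → Incl v (Dc v l) ξ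
  Dc-included-below Dcₖ k<n 1≤l l≤k (s , B) (Bₛ , oB) =
    included-below (λ A Aₛ oA → Dcₖ (s , A) (trans Aₛ Bₛ , oA)) k<n (≤-trans (≤-reflexive oB) l≤k) B-d
    where
    B-d = ∧-conicalˡ _ _ (proj₂ (count-witness (others s B) (≤-trans 1≤l (≤-reflexive (sym oB)))))

  Dw-included-below-Dc : ∀ {k l} → Incl v (Dc v k) ξ → k < 2 ^ v → l < k → Incl v (Dw v l) ξ
  Dw-included-below-Dc Dcₖ k<n l<k (s , B) (Bₛ , oB) =
    included-below-irreflexive Dcₖ k<n Bₛ (≤-trans (s≤s (≤-reflexive oB)) l<k)

Dd₀⊆Dw₀ : ∀ v → Incl v (Dd₀ v) (Dw v 0)
Dd₀⊆Dw₀ v (s , ε) (εₛ , only-s) = εₛ , othersOn-only-root s ε only-s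

theorem10 : (v : ℕ) → 1 ≤ v → (S : Form → Set) → IsNormalLogic S →
    ∃ (λ (a : Atom v) → ⟦⟦ S ⟧⟧ v a) →
    (Incl v (Vv₀ v) (⟦⟦ S ⟧⟧ v) ⊎ Incl v (Dd₀ v) (⟦⟦ S ⟧⟧ v))
    × (∀ k → 1 ≤ k → k < 2 ^ v → Incl v (Dw v k) (⟦⟦ S ⟧⟧ v) →
         Incl v (Dd₀ v) (⟦⟦ S ⟧⟧ v)
           × (∀ l → 1 ≤ l → l < k → Incl v (Dw v l) (⟦⟦ S ⟧⟧ v)))
    × (∀ k → 1 ≤ k → k < 2 ^ v → Incl v (Dc v k) (⟦⟦ S ⟧⟧ v) →
         Incl v (Dd₀ v) (⟦⟦ S ⟧⟧ v)
           × (∀ l → 1 ≤ l → l < k → Incl v (Dw v l) (⟦⟦ S ⟧⟧ v))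
           × (∀ l → 1 ≤ l → l < k → Incl v (Dc v l) (⟦⟦ S ⟧⟧ v)))
-- The argument works for every v.
theorem10 v _ S S-normal nonempty =
  Vv₀-or-Dd₀-included S-normal nonempty ,
  (λ k _ k<n Dwₖ →
     (λ a → Dw-included-below S-normal Dwₖ k<n z≤n a ∘ Dd₀⊆Dw₀ v a) ,
     (λ l _ l<k → Dw-included-below S-normal Dwₖ k<n (<⇒≤ l<k))) ,
  (λ k 1≤k k<n Dcₖ →
     (λ a → Dw-included-below-Dc S-normal Dcₖ k<n 1≤k a ∘ Dd₀⊆Dw₀ v a) ,
     (λ l _ l<k → Dw-included-below-Dc S-normal Dcₖ k<n l<k) ,
     (λ l 1≤l l<k → Dc-included-below S-normal Dcₖ k<n 1≤l (<⇒≤ l<k)))
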